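{- Let $g(x)=\sum_{i=1}^na_ix_i-b\ge0$ be a linear constraint on $x\in\{0,1\}^n$ that is a Single Vertex Cutting (SVC) constraint. Then $b\neq0$ and $a_i\neq0$ for all $i\in\{1,\dots,n\}$, and, letting $P=\{i\mid a_i<0\}$, we have $\sum_{i\in P}a_i<b$ but $\sum_{i\in Q}a_i>b$ for all $Q\subseteq N$ with $Q\neq P$.
   Context: $N=\{1,\dots,n\}$. For $I\subseteq N$, $x_I\in\{0,1\}^n$ has $x_i=1$ iff $i\in I$. A constraint $g(x)\ge0$ is Single Vertex Cutting (SVC) if there is exactly one $I\subseteq N$ with $g(x_I)<0$, and $g(x_J)>0$ for every $J\subseteq N$ with $J\neq I$.
   Formalization: The coefficients $a_i$ and the constant $b$ are rational. -}

module Defs where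

open import Data.Nat using (ℕ)
open import Data.Fin using (Fin)
open import Data.Fin.Subset using (Subset; _∈_)
open import Data.Bool using (Bool; true; false)
open import Data.Vec using (Vec; []; _∷_; lookup; map)
open import Relation.Nullary.Decidable using (⌊_⌋)
open import Data.Rational using (ℚ; 0ℚ; 1ℚ; _+_; _*_; _-_; _<_; _<?_)
open import Data.Product using (∃; _×_)
open import Relation.Binary.PropositionalEquality using (_≡_; _≢_)

toℚ : Bool → ℚ
toℚ true  = 1ℚ
toℚ false = 0ℚ

-- Σ_i a_i x_i  for a coefficient vector a and 0/1 point x (given as a subset I, x = x_I)
dot : ∀ {n} → Vec ℚ n → Subset n → ℚ
dot []       []       = 0ℚ
dot (a ∷ as) (x ∷ xs) = a * toℚ x + dot as xs

sumOver : ∀ {n} → Vec ℚ n → Subset n → ℚ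
sumOver []       []           = 0ℚ
sumOver (a ∷ as) (true ∷ xs)  = a + sumOver as xs
sumOver (a ∷ as) (false ∷ xs) = sumOver as xs

linearG : ∀ {n} → Vec ℚ n → ℚ → Subset n → ℚ
linearG a b I = dot a I - b

IsSVC : ∀ {n} → (Subset n → ℚ) → Set
IsSVC {n} g = ∃ λ (I : Subset n) →
  (g I < 0ℚ) × (∀ (J : Subset n) → J ≢ I → 0ℚ < g J)

negSupport : ∀ {n} → Vec ℚ n → Subset n
negSupport = map (λ a → ⌊ a <? 0ℚ ⌋)

{-# OPTIONS --safe #-}
-- The point x_P minimises Σ aᵢxᵢ over {0,1}ⁿ, so g(x_P) ≤ g(x_I) < 0 for the cut vertex I;
-- as I is the only point where an SVC constraint is not positive, P = I.  Flipping a
-- coordinate with aᵢ = 0 would give a second point with the same (negative) value, and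
-- b ≠ 0 because g(x_∅) = -b while an SVC constraint never vanishes.
module Submission where

open import Defs
open import Data.Nat using (ℕ)
open import Data.Fin using (Fin; zero; suc)
open import Data.Fin.Subset using (Subset; ⊥)
open import Data.Vec using (Vec; []; _∷_; lookup; updateAt)
open import Data.Vec.Properties using (≡-dec; lookup∘updateAt)
open import Data.Bool using (Bool; true; false; not; _≟_)
open import Data.Bool.Properties using (not-¬)
open import Data.Rational using (ℚ; 0ℚ; _+_; _*_; _-_; _<_; _≤_; _<?_)
open import Data.Rational.Properties
  using ( +-0-group; +-identityˡ; +-mono-≤; +-monoʳ-≤; +-monoˡ-≤; +-monoˡ-<; *-identityʳ; *-zeroˡ
        ; *-zeroʳ; ≤-refl; ≤-reflexive; ≤-trans; <⇒≤; <⇒≢; <-≤-trans; <-irrefl; ≮⇒≥ )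
open import Algebra.Properties.Group +-0-group using (//-rightDividesˡ)
open import Data.Product using (_×_; _,_; proj₁)
open import Relation.Nullary using (yes; no; contradiction)
open import Relation.Binary.PropositionalEquality
  using (_≡_; _≢_; refl; sym; trans; cong; cong₂; subst; subst₂)

private
  variable
    n : ℕ

p-q<0⇒p<q : ∀ {p q} → p - q < 0ℚ → p < q
p-q<0⇒p<q {p} {q} p-q<0 =
  subst₂ _<_ (//-rightDividesˡ q p) (+-identityˡ q) (+-monoˡ-< q p-q<0)

0<p-q⇒q<p : ∀ {p q} → 0ℚ < p - q → q < p
0<p-q⇒q<p {p} {q} 0<p-q =
  subst₂ _<_ (+-identityˡ q) (//-rightDividesˡ q p) (+-monoˡ-< q 0<p-q)

module _ {g : Subset n → ℚ} where

  svc-nonpositive⇒witness : (svc : IsSVC g) → ∀ J → g J ≤ 0ℚ → J ≡ proj₁ svc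
  svc-nonpositive⇒witness (I , _ , g>0) J gJ≤0 with ≡-dec _≟_ J I
  ... | yes J≡I = J≡I
  ... | no  J≢I = contradiction (<-≤-trans (g>0 J J≢I) gJ≤0) (<-irrefl refl)

  svc-nonzero : IsSVC g → ∀ J → g J ≢ 0ℚ
  svc-nonzero svc@(I , gI<0 , _) J gJ≡0
    with svc-nonpositive⇒witness svc J (≤-reflexive gJ≡0)
  ... | refl = <⇒≢ gI<0 gJ≡0

dot≡sumOver : (a : Vec ℚ n) (Q : Subset n) → dot a Q ≡ sumOver a Q
dot≡sumOver []       []          = refl
dot≡sumOver (a ∷ as) (true  ∷ Q) = cong₂ _+_ (*-identityʳ a) (dot≡sumOver as Q)
dot≡sumOver (a ∷ as) (false ∷ Q) =
  trans (cong₂ _+_ (*-zeroʳ a) (dot≡sumOver as Q)) (+-identityˡ _)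

linearG≡sumOver-b : (a : Vec ℚ n) (b : ℚ) (Q : Subset n) → linearG a b Q ≡ sumOver a Q - b
linearG≡sumOver-b a b Q = cong (_- b) (dot≡sumOver a Q)

linearG<0⇒sumOver<b : (a : Vec ℚ n) (b : ℚ) (Q : Subset n) →
                      linearG a b Q < 0ℚ → sumOver a Q < b
linearG<0⇒sumOver<b a b Q gQ<0 = p-q<0⇒p<q (subst (_< 0ℚ) (linearG≡sumOver-b a b Q) gQ<0)

linearG>0⇒b<sumOver : (a : Vec ℚ n) (b : ℚ) (Q : Subset n) →
                      0ℚ < linearG a b Q → b < sumOver a Q
linearG>0⇒b<sumOver a b Q 0<gQ = 0<p-q⇒q<p (subst (0ℚ <_) (linearG≡sumOver-b a b Q) 0<gQ)

sumOver-⊥ : (a : Vec ℚ n) → sumOver a ⊥ ≡ 0ℚ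
sumOver-⊥ []       = refl
sumOver-⊥ (a ∷ as) = sumOver-⊥ as

sumOver-negSupport-minimal : (a : Vec ℚ n) (Q : Subset n) →
                             sumOver a (negSupport a) ≤ sumOver a Q
sumOver-negSupport-minimal []       []      = ≤-refl
sumOver-negSupport-minimal (a ∷ as) (q ∷ Q) with a <? 0ℚ | q
... | yes _   | true  = +-monoʳ-≤ a (sumOver-negSupport-minimal as Q)
... | yes a<0 | false = ≤-trans (+-mono-≤ (<⇒≤ a<0) (sumOver-negSupport-minimal as Q))
                                (≤-reflexive (+-identityˡ _))
... | no  a≮0 | true  = ≤-trans (≤-reflexive (sym (+-identityˡ _)))
                                (+-mono-≤ (≮⇒≥ a≮0) (sumOver-negSupport-minimal as Q))
... | no  _   | false = sumOver-negSupport-minimal as Q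

linearG-negSupport-minimal : (a : Vec ℚ n) (b : ℚ) (Q : Subset n) →
                             linearG a b (negSupport a) ≤ linearG a b Q
linearG-negSupport-minimal a b Q =
  subst₂ _≤_ (sym (linearG≡sumOver-b a b (negSupport a))) (sym (linearG≡sumOver-b a b Q))
         (+-monoˡ-≤ _ (sumOver-negSupport-minimal a Q))

dot-updateAt-zero : (a : Vec ℚ n) (I : Subset n) (i : Fin n) {f : Bool → Bool} →
                    lookup a i ≡ 0ℚ → dot a (updateAt I i f) ≡ dot a I
dot-updateAt-zero (a ∷ as) (x ∷ I) zero    {f} refl =
  cong (_+ dot as I) (trans (*-zeroˡ (toℚ (f x))) (sym (*-zeroˡ (toℚ x))))
dot-updateAt-zero (a ∷ as) (x ∷ I) (suc i) aᵢ≡0 =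
  cong (a * toℚ x +_) (dot-updateAt-zero as I i aᵢ≡0)

updateAt-not≢ : (I : Subset n) (i : Fin n) → updateAt I i not ≢ I
updateAt-not≢ I i eq =
  not-¬ refl (trans (sym (cong (λ J → lookup J i) eq)) (lookup∘updateAt i I))

lemma6 : ∀ (n : ℕ) (a : Vec ℚ n) (b : ℚ) →
    IsSVC (linearG a b) →
    (b ≢ 0ℚ)
    × (∀ (i : Fin n) → lookup a i ≢ 0ℚ)
    × (sumOver a (negSupport a) < b)
    × (∀ (Q : Subset n) → Q ≢ negSupport a → b < sumOver a Q)
lemma6 n a b svc@(I , gI<0 , g>0) = b≢0 , aᵢ≢0 , P<b , b<Q
  where
  P≡I : negSupport a ≡ I
  P≡I = svc-nonpositive⇒witness svc (negSupport a)
          (≤-trans (linearG-negSupport-minimal a b I) (<⇒≤ gI<0))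

  b≢0 : b ≢ 0ℚ
  b≢0 refl = svc-nonzero svc ⊥ (trans (linearG≡sumOver-b a 0ℚ ⊥) (cong (_- 0ℚ) (sumOver-⊥ a)))

  aᵢ≢0 : ∀ i → lookup a i ≢ 0ℚ
  aᵢ≢0 i aᵢ≡0 = updateAt-not≢ I i (svc-nonpositive⇒witness svc (updateAt I i not)
    (≤-trans (≤-reflexive (cong (_- b) (dot-updateAt-zero a I i aᵢ≡0))) (<⇒≤ gI<0)))

  P<b : sumOver a (negSupport a) < b
  P<b rewrite P≡I = linearG<0⇒sumOver<b a b I gI<0

  b<Q : ∀ Q → Q ≢ negSupport a → b < sumOver a Q
  b<Q Q Q≢P = linearG>0⇒b<sumOver a b Q (g>0 Q (λ Q≡I → Q≢P (trans Q≡I (sym P≡I))))
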